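{- Let $M$ be a system F term and $t$ a regular pseudo-term. Then $t$ is a decoration of $M$ (i.e. $t^-=M$) if and only if there is an instantiation $\phi$ admissible for the free decoration $\tilde M$ of $M$ such that $\phi(\tilde M)=t$.
   Context: System F types $T ::= \alpha\mid T\to U\mid\forall\alpha.T$; Church-style system F terms $x^T$, $\lambda x^T.M$, $(M)N$, $\Lambda\alpha.M$, $(M)T$. $DLAL\star$ types: linear $A ::= \alpha\mid D\multimap A\mid\forall\alpha.A\mid\S A$, arbitrary $D ::= A\mid !A$. Pseudo-terms: $t ::= x^D\mid\lambda x^D.t\mid(t)t\mid\Lambda\alpha.t\mid(t)A\mid\S t\mid\bar\S t$ ($A$ linear). Erasure $(\cdot)^-$ forgets $\S,\bar\S,!$, maps $\multimap$ to $\to$, $x^D$ to $x^{D^- }$, $(t)A$ to $(t)A^-$. A pseudo-term is regular if it has no subterm $\S\bar\S u$ or $\bar\S\S u$; for $k\in\mathbb Z$, $\S^k u$ denotes $k$ copies of $\S$ if $k\ge0$ and $-k$ copies of $\bar\S$ if $k<0$. Parameters: integer parameters $\mathsf m,\mathsf n,\dots$ (ranging over $\mathbb Z$), boolean parameters $\mathsf b,\dots$ (ranging over $\{0,1\}$), linear combinations $\mathsf c=\mathsf n_1+\dots+\mathsf n_k$ ($k\ge0$; $\mathsf 0$ when $k=0$). Parameterized types (p-types): $F ::= \alpha\mid D\multimap A\mid\forall\alpha.A$, linear p-types $A ::= \S^{\mathsf c}F$, bang p-types $D ::= \S^{\mathsf b,\mathsf c}F$. For $A=\S^{\mathsf c}F$,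 $B[A/\alpha]$ replaces each $\S^{\mathsf c'}\alpha$ by $\S^{\mathsf c'+\mathsf c}F$ and each $\S^{\mathsf b,\mathsf c'}\alpha$ by $\S^{\mathsf b,\mathsf c'+\mathsf c}F$. P-terms: $u ::= x^D\mid\lambda x^D.t\mid(t)t\mid\Lambda\alpha.t\mid(t)A$, $t ::= \S^{\mathsf m}u$ ($\mathsf m$ an integer parameter, $D$ bang p-type, $A$ linear p-type). Erasure of p-types/p-terms forgets modalities and parameters. An instantiation $\phi=(\phi^b,\phi^i)$ maps boolean parameters to $\{0,1\}$ and integer parameters to $\mathbb Z$, extended additively to linear combinations. $\phi$ is admissible for a p-type $E$ if $\phi^i(\mathsf c)\ge0$ for every linear combination $\mathsf c$ in $E$, and $\phi^b(\mathsf b)=1$ implies $\phi^i(\mathsf c)\ge1$ whenever $\S^{\mathsf b,\mathsf c}F$ occurs in $E$; it is admissible for a p-term if admissible for all p-types in it. Then $\phi(\S^{\mathsf c}F)=\S^{\phi^i(\mathsf c)}\phi(F)$; $\phi(\S^{\mathsf b,\mathsf c}F)=\S^{\phi^i(\mathsf c)}\phi(F)$ if $\phi^b(\mathsf b)=0$ and $!\S^{\phi^i(\mathsf c)-1}\phi(F)$ otherwise; $\phi$ commutes with other connectives. $\phi(t)$ replaces each $\S^{\mathsf m}u$ by $\S^{\phi^i(\mathsf m)}u$, each $x^D$ by $x^{\phi(D)}$ and each $(t)A$ by $(t)\phi(A)$. A free linear (resp. bang) decoration of a system F type $T$ is a linear (resp. bang) p-type $E$ with $E^-=T$, each linear combination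 in $E$ a single integer parameter, and all parameters of $E$ mutually distinct. The free decoration $\tilde M$ of $M$ (unique up to renaming of parameters): each variable $x^T$ is assigned $x^D$ with $D$ a free bang decoration of $T$, distinct variables getting decorations with disjoint parameter sets; then $\widetilde{x^T}=\S^{\mathsf m}x^D$, $\widetilde{\lambda x^T.M}=\S^{\mathsf m}\lambda x^{D}.\tilde M$, $\widetilde{(M)N}=\S^{\mathsf m}((\tilde M)\tilde N)$, $\widetilde{\Lambda\alpha.M}=\S^{\mathsf m}\Lambda\alpha.\tilde M$, $\widetilde{(M)T}=\S^{\mathsf m}((\tilde M)A)$, where each $\mathsf m$ is a fresh integer parameter and $A$ is a free linear decoration of $T$ with parameters disjoint from those in $\tilde M$.
   Formalization: The pseudo-term t is also assumed to give any two occurrences of a variable x, binders λx included, whose decorations have equal erasure one and the same decoration D. The statement above fails without it. -}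

module Defs where

open import Data.Nat using (ℕ; zero; suc; _∸_)
open import Data.Integer using (ℤ; +_; -[1+_]; ∣_∣) renaming (_+_ to _+ℤ_; _≤_ to _≤ℤ_)
open import Data.Bool using (Bool; true; false)
open import Data.List using (List; []; _∷_; [_]; foldr; map)
open import Data.Product using (Σ; _×_; _,_)
open import Data.Sum using (_⊎_)
open import Data.Unit using (⊤)
open import Data.Empty using (⊥)
open import Relation.Nullary using (¬_)
open import Relation.Binary.PropositionalEquality using (_≡_)

-- System F (Church style). Term and type variables are named by ℕ.

data Ty : Set where
  tvar : ℕ → Ty
  _⇒_  : Ty → Ty → Ty
  all  : ℕ → Ty → Ty

data Tm : Set where
  var  : ℕ → Ty → Tm
  lam  : ℕ → Ty → Tm → Tm
  app  : Tm → Tm → Tm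
  tlam : ℕ → Tm → Tm
  tapp : Tm → Ty → Tm

mutual
  data LTy : Set where
    tvar : ℕ → LTy
    _⊸_  : DTy → LTy → LTy
    all  : ℕ → LTy → LTy
    §    : LTy → LTy

  data DTy : Set where
    lin  : LTy → DTy
    !    : LTy → DTy

data PTm : Set where
  var  : ℕ → DTy → PTm
  lam  : ℕ → DTy → PTm → PTm
  app  : PTm → PTm → PTm
  tlam : ℕ → PTm → PTm
  tapp : PTm → LTy → PTm
  §    : PTm → PTm
  §̄    : PTm → PTm

mutual
  eraseL : LTy → Ty
  eraseL (tvar α) = tvar α
  eraseL (D ⊸ A)  = eraseD D ⇒ eraseL A
  eraseL (all α A) = all α (eraseL A)
  eraseL (§ A)    = eraseL A

  eraseD : DTy → Ty
  eraseD (lin A) = eraseL A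
  eraseD (! A)   = eraseL A

eraseT : PTm → Tm
eraseT (var x D)   = var x (eraseD D)
eraseT (lam x D t) = lam x (eraseD D) (eraseT t)
eraseT (app t u)   = app (eraseT t) (eraseT u)
eraseT (tlam α t)  = tlam α (eraseT t)
eraseT (tapp t A)  = tapp (eraseT t) (eraseL A)
eraseT (§ t)       = eraseT t
eraseT (§̄ t)       = eraseT t

data _⊑_ : PTm → PTm → Set where
  here  : ∀ {t} → t ⊑ t
  lam   : ∀ {u x D t} → u ⊑ t → u ⊑ lam x D t
  appˡ  : ∀ {u t s} → u ⊑ t → u ⊑ app t s
  appʳ  : ∀ {u t s} → u ⊑ s → u ⊑ app t s
  tlam  : ∀ {u α t} → u ⊑ t → u ⊑ tlam α t
  tapp  : ∀ {u t A} → u ⊑ t → u ⊑ tapp t A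
  §     : ∀ {u t} → u ⊑ t → u ⊑ § t
  §̄     : ∀ {u t} → u ⊑ t → u ⊑ §̄ t

Regular : PTm → Set
Regular t = (u : PTm) → ¬ (§ (§̄ u) ⊑ t) × ¬ (§̄ (§ u) ⊑ t)

Occ : ℕ → DTy → PTm → Set
Occ x D t = (var x D ⊑ t) ⊎ Σ PTm (λ s → lam x D s ⊑ t)

-- Church-style convention: a variable x^T of system F is determined by its
-- name and type, so the occurrences of a variable x^T decorated in t must all
-- carry the same decoration D.
VarConsistent : PTm → Set
VarConsistent t = ∀ x D D′ → Occ x D t → Occ x D′ t → eraseD D ≡ eraseD D′ → D ≡ D′

-- Parameter names are structured (so freshness/distinctness in
-- the free decoration is by construction).

data PName : Set where
  varP  : ℕ → Ty → List ℕ → PName       -- parameters in the decoration of variable x^T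
  nodeP : List ℕ → PName                -- the §^m of a term node
  targP : List ℕ → List ℕ → PName       -- parameters in the decoration of a type argument

-- linear combination n₁ + … + nₖ of integer parameters (0 when empty)
Comb : Set
Comb = List PName

mutual
  data PF : Set where
    tvar : ℕ → PF
    _⊸_  : PD → PA → PF
    all  : ℕ → PA → PF

  data PA : Set where           -- linear p-types §^c F
    sec : Comb → PF → PA

  data PD : Set where           -- bang p-types §^{b,c} F
    bsec : PName → Comb → PF → PD

mutual
  data PU : Set where
    var  : ℕ → PD → PU
    lam  : ℕ → PD → PT → PU
    app  : PT → PT → PU
    tlam : ℕ → PT → PU
    tapp : PT → PA → PU

  data PT : Set where           -- t ::= §^m u
    sec : PName → PU → PT

record Inst : Set where
  field
    φb : PName → Bool
    φi : PName → ℤ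
open Inst public

evalC : Inst → Comb → ℤ
evalC φ c = foldr (λ n z → φi φ n +ℤ z) (+ 0) c

mutual
  AdmF : Inst → PF → Set
  AdmF φ (tvar α)  = ⊤
  AdmF φ (D ⊸ A)   = AdmD φ D × AdmA φ A
  AdmF φ (all α A) = AdmA φ A

  AdmA : Inst → PA → Set
  AdmA φ (sec c F) = (+ 0 ≤ℤ evalC φ c) × AdmF φ F

  AdmD : Inst → PD → Set
  AdmD φ (bsec b c F) = (+ 0 ≤ℤ evalC φ c) × (φb φ b ≡ true → + 1 ≤ℤ evalC φ c) × AdmF φ F

mutual
  AdmU : Inst → PU → Set
  AdmU φ (var x D)   = AdmD φ D
  AdmU φ (lam x D t) = AdmD φ D × AdmT φ t
  AdmU φ (app t s)   = AdmT φ t × AdmT φ s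
  AdmU φ (tlam α t)  = AdmT φ t
  AdmU φ (tapp t A)  = AdmT φ t × AdmA φ A

  AdmT : Inst → PT → Set
  AdmT φ (sec m u) = AdmU φ u

§^ : ℕ → LTy → LTy
§^ zero A    = A
§^ (suc n) A = § (§^ n A)

-- application of an instantiation to p-types (meaningful for admissible φ,
-- where all evaluated linear combinations are ≥ 0)
mutual
  instF : Inst → PF → LTy
  instF φ (tvar α)  = tvar α
  instF φ (D ⊸ A)   = instD φ D ⊸ instA φ A
  instF φ (all α A) = all α (instA φ A)

  instA : Inst → PA → LTy
  instA φ (sec c F) = §^ ∣ evalC φ c ∣ (instF φ F)

  instD : Inst → PD → DTy
  instD φ (bsec b c F) with φb φ b
  ... | false = lin (§^ ∣ evalC φ c ∣ (instF φ F))
  ... | true  = ! (§^ (∣ evalC φ c ∣ ∸ 1) (instF φ F))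

§ᶻ : ℤ → PTm → PTm
§ᶻ (+ zero)     u = u
§ᶻ (+ suc n)    u = § (§ᶻ (+ n) u)
§ᶻ -[1+ zero ]  u = §̄ u
§ᶻ -[1+ suc n ] u = §̄ (§ᶻ -[1+ n ] u)

mutual
  instU : Inst → PU → PTm
  instU φ (var x D)   = var x (instD φ D)
  instU φ (lam x D t) = lam x (instD φ D) (instT φ t)
  instU φ (app t s)   = app (instT φ t) (instT φ s)
  instU φ (tlam α t)  = tlam α (instT φ t)
  instU φ (tapp t A)  = tapp (instT φ t) (instA φ A)

  instT : Inst → PT → PTm
  instT φ (sec m u) = §ᶻ (φi φ m) (instU φ u)

-- A name generator g : List ℕ → PName assigns parameter
-- names to positions inside a type; the node at position p gets integer
-- parameter g p and (for bang decorations) boolean parameter g (p ++ [0]);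
-- children use positions 1 ∷ _ and 2 ∷ _, so all parameters are distinct.

mutual
  freeF : (List ℕ → PName) → Ty → PF
  freeF g (tvar α)  = tvar α
  freeF g (T ⇒ U)   = freeBang (λ p → g (1 ∷ p)) T ⊸ freeLin (λ p → g (2 ∷ p)) U
  freeF g (all α T) = all α (freeLin (λ p → g (1 ∷ p)) T)

  freeLin : (List ℕ → PName) → Ty → PA
  freeLin g T = sec [ g [] ] (freeF g T)

  freeBang : (List ℕ → PName) → Ty → PD
  freeBang g T = bsec (g [ 0 ]) [ g [] ] (freeF g T)

-- decoration of the variable x^T (same for all occurrences, disjoint
-- parameters for distinct variables)
varDec : ℕ → Ty → PD
varDec x T = freeBang (varP x T) T

-- free decoration of a term; p is the (reversed) position of the node
freeTm′ : List ℕ → Tm → PT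
freeTm′ p (var x T)   = sec (nodeP p) (var x (varDec x T))
freeTm′ p (lam x T M) = sec (nodeP p) (lam x (varDec x T) (freeTm′ (0 ∷ p) M))
freeTm′ p (app M N)   = sec (nodeP p) (app (freeTm′ (0 ∷ p) M) (freeTm′ (1 ∷ p) N))
freeTm′ p (tlam α M)  = sec (nodeP p) (tlam α (freeTm′ (0 ∷ p) M))
freeTm′ p (tapp M T)  = sec (nodeP p) (tapp (freeTm′ (0 ∷ p) M) (freeLin (targP p) T))

freeTm : Tm → PT
freeTm M = freeTm′ [] M

-- Erasing an instantiation of the free decoration only forgets modalities,
-- so it gives back M. Conversely, a regular decoration t of M determines the
-- parameters of M̃: that of a term node is the exponent k of the prefix §ᵏ of
-- the corresponding subterm of t (a single integer because t is regular),
-- those of a type argument are read off its § counts and bangs, and those of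
-- a variable x^T off any decoration of x^T in t, which is unique by variable
-- consistency.

module Submission where

open import Defs
open import Data.Product using (Σ; _×_)
open import Relation.Binary.PropositionalEquality using (_≡_)
open import Function.Bundles using (_⇔_)

open import Data.Bool using (Bool; true; false)
open import Data.Empty using (⊥-elim)
open import Data.Integer using (ℤ; +_; -[1+_]; ∣_∣; +≤+) renaming (_≤_ to _≤ℤ_)
open import Data.Integer.Properties using (+-identityʳ)
open import Data.List using (List; []; _∷_; [_]; _++_)
open import Data.List.Membership.Propositional using (_∈_; find; lose)
open import Data.List.Membership.Propositional.Properties using (∈-++⁺ˡ; ∈-++⁺ʳ; ∈-++⁻)
open import Data.List.Relation.Unary.Any using (here; there; any?)
open import Data.Nat using (ℕ; zero; suc; _∸_; z≤n; s≤s; _≟_)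
open import Data.Product using (_,_; proj₁; proj₂; uncurry)
open import Data.Sum using (inj₁; inj₂)
open import Data.Unit using (tt)
open import Function using (_∘_)
open import Function.Bundles using (mk⇔)
open import Relation.Binary.Definitions using (DecidableEquality)
open import Relation.Binary.PropositionalEquality using (refl; sym; trans; cong; cong₂; _≗_)
open import Relation.Nullary using (Dec; yes; no; map′; _×-dec_)

tvar-injective : ∀ {α β} → Ty.tvar α ≡ tvar β → α ≡ β
tvar-injective refl = refl

⇒-injective : ∀ {T U T′ U′} → T ⇒ U ≡ T′ ⇒ U′ → T ≡ T′ × U ≡ U′
⇒-injective refl = refl , refl

all-injective : ∀ {α β T U} → Ty.all α T ≡ all β U → α ≡ β × T ≡ U
all-injective refl = refl , refl

_≟ᵀ_ : DecidableEquality Ty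
tvar α ≟ᵀ tvar β = map′ (cong tvar) tvar-injective (α ≟ β)
(T ⇒ U) ≟ᵀ (T′ ⇒ U′) = map′ (uncurry (cong₂ _⇒_)) ⇒-injective (T ≟ᵀ T′ ×-dec U ≟ᵀ U′)
all α T ≟ᵀ all β U = map′ (uncurry (cong₂ all)) all-injective (α ≟ β ×-dec T ≟ᵀ U)
tvar _ ≟ᵀ (_ ⇒ _) = no λ ()
tvar _ ≟ᵀ all _ _ = no λ ()
(_ ⇒ _) ≟ᵀ tvar _ = no λ ()
(_ ⇒ _) ≟ᵀ all _ _ = no λ ()
all _ _ ≟ᵀ tvar _ = no λ ()
all _ _ ≟ᵀ (_ ⇒ _) = no λ ()

§depth : LTy → ℕ
§depth (§ A) = suc (§depth A)
§depth _ = 0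

§body : LTy → LTy
§body (§ A) = §body A
§body A = A

§^-§depth-§body : ∀ A → §^ (§depth A) (§body A) ≡ A
§^-§depth-§body (tvar α) = refl
§^-§depth-§body (D ⊸ A) = refl
§^-§depth-§body (all α A) = refl
§^-§depth-§body (§ A) = cong § (§^-§depth-§body A)

-- The values the parameters of freeLin/freeBang must take to instantiate to a
-- given type, by position: [] holds the § count, [ 0 ] the bang flag, and
-- i ∷ q (i = 1, 2) position q in the i-th immediate subtype.
mutual
  intParamL : LTy → List ℕ → ℤ
  intParamL A []      = + §depth A
  intParamL A (i ∷ q) = intParamF i (§body A) q

  intParamD : DTy → List ℕ → ℤ
  intParamD (lin A) q  = intParamL A q
  intParamD (! A)   [] = + suc (§depth A)
  intParamD (! A)   q  = intParamL A q

  intParamF : ℕ → LTy → List ℕ → ℤ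
  intParamF 1 (D ⊸ B)   q = intParamD D q
  intParamF 2 (D ⊸ B)   q = intParamL B q
  intParamF 1 (all α B) q = intParamL B q
  intParamF _ _         _ = + 0

mutual
  boolParamL : LTy → List ℕ → Bool
  boolParamL A []      = false
  boolParamL A (i ∷ q) = boolParamF i (§body A) q

  boolParamD : DTy → List ℕ → Bool
  boolParamD (lin A) q        = boolParamL A q
  boolParamD (! A)   (0 ∷ []) = true
  boolParamD (! A)   q        = boolParamL A q

  boolParamF : ℕ → LTy → List ℕ → Bool
  boolParamF 1 (D ⊸ B)   q = boolParamD D q
  boolParamF 2 (D ⊸ B)   q = boolParamL B q
  boolParamF 1 (all α B) q = boolParamL B q
  boolParamF _ _         _ = false

record Agrees (φ : Inst) (g : List ℕ → PName) (ints : List ℕ → ℤ) (bools : List ℕ → Bool) : Set where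
  constructor agree
  field
    ints≡  : φi φ ∘ g ≗ ints
    bools≡ : φb φ ∘ g ≗ bools

AgreesBelow : Inst → (List ℕ → PName) → LTy → Set
AgreesBelow φ g F = ∀ i → Agrees φ (g ∘ (suc i ∷_)) (intParamF (suc i) F) (boolParamF (suc i) F)

below : ∀ {φ g ints bools} → Agrees φ g ints bools → ∀ i →
  Agrees φ (g ∘ (suc i ∷_)) (ints ∘ (suc i ∷_)) (bools ∘ (suc i ∷_))
below (agree ints≡ bools≡) i = agree (ints≡ ∘ (suc i ∷_)) (bools≡ ∘ (suc i ∷_))

evalC-root : ∀ {φ g ints bools} → Agrees φ g ints bools → evalC φ [ g [] ] ≡ ints []
evalC-root {φ} {g} (agree ints≡ _) = trans (+-identityʳ (φi φ (g []))) (ints≡ [])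

≡+⇒0≤ : ∀ {k n} → k ≡ + n → + 0 ≤ℤ k
≡+⇒0≤ refl = +≤+ z≤n

≡+suc⇒1≤ : ∀ {k n} → k ≡ + suc n → + 1 ≤ℤ k
≡+suc⇒1≤ refl = +≤+ (s≤s z≤n)

mutual
  freeF-agrees : ∀ A {φ g} → AgreesBelow φ g (§body A) →
    AdmF φ (freeF g (eraseL A)) × instF φ (freeF g (eraseL A)) ≡ §body A
  freeF-agrees (tvar α)  _           = tt , refl
  freeF-agrees (D ⊸ B)   agreesBelow =
    let admD , instD≡ = freeBang-agrees D (agreesBelow 0)
        admB , instB≡ = freeLin-agrees B (agreesBelow 1)
    in (admD , admB) , cong₂ _⊸_ instD≡ instB≡
  freeF-agrees (all α B) agreesBelow =
    let admB , instB≡ = freeLin-agrees B (agreesBelow 0)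
    in admB , cong (all α) instB≡
  freeF-agrees (§ A)     agreesBelow = freeF-agrees A agreesBelow

  freeLin-agrees : ∀ A {φ g} → Agrees φ g (intParamL A) (boolParamL A) →
    AdmA φ (freeLin g (eraseL A)) × instA φ (freeLin g (eraseL A)) ≡ A
  freeLin-agrees A agrees =
    let admF , instF≡ = freeF-agrees A (below agrees)
        depth≡ = evalC-root agrees
    in (≡+⇒0≤ depth≡ , admF) , trans (cong₂ §^ (cong ∣_∣ depth≡) instF≡) (§^-§depth-§body A)

  freeBang-agrees : ∀ D {φ g} → Agrees φ g (intParamD D) (boolParamD D) →
    AdmD φ (freeBang g (eraseD D)) × instD φ (freeBang g (eraseD D)) ≡ D
  freeBang-agrees (lin A) {φ} {g} agrees@(agree _ bools≡) with φb φ (g [ 0 ]) | bools≡ [ 0 ]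
  ... | false | refl =
    let (0≤ , admF) , instA≡ = freeLin-agrees A agrees
    in (0≤ , (λ ()) , admF) , cong lin instA≡
  freeBang-agrees (! A) {φ} {g} agrees@(agree _ bools≡) with φb φ (g [ 0 ]) | bools≡ [ 0 ]
  ... | true | refl =
    let admF , instF≡ = freeF-agrees A (below agrees)
        depth≡ = evalC-root agrees
    in (≡+⇒0≤ depth≡ , (λ _ → ≡+suc⇒1≤ depth≡) , admF) ,
       cong ! (trans (cong₂ §^ (cong (λ k → ∣ k ∣ ∸ 1) depth≡) instF≡) (§^-§depth-§body A))

eraseL-§^ : ∀ n A → eraseL (§^ n A) ≡ eraseL A
eraseL-§^ zero    A = refl
eraseL-§^ (suc n) A = eraseL-§^ n A

eraseT-§ᶻ : ∀ k u → eraseT (§ᶻ k u) ≡ eraseT u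
eraseT-§ᶻ (+ zero)      u = refl
eraseT-§ᶻ (+ suc n)     u = eraseT-§ᶻ (+ n) u
eraseT-§ᶻ -[1+ zero ]   u = refl
eraseT-§ᶻ -[1+ suc n ]  u = eraseT-§ᶻ -[1+ n ] u

mutual
  eraseL-instF-freeF : ∀ φ g T → eraseL (instF φ (freeF g T)) ≡ T
  eraseL-instF-freeF φ g (tvar α)  = refl
  eraseL-instF-freeF φ g (T ⇒ U)   =
    cong₂ _⇒_ (eraseD-instD-freeBang φ (g ∘ (1 ∷_)) T) (eraseL-instA-freeLin φ (g ∘ (2 ∷_)) U)
  eraseL-instF-freeF φ g (all α T) = cong (all α) (eraseL-instA-freeLin φ (g ∘ (1 ∷_)) T)

  eraseL-instA-freeLin : ∀ φ g T → eraseL (instA φ (freeLin g T)) ≡ T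
  eraseL-instA-freeLin φ g T =
    trans (eraseL-§^ ∣ evalC φ [ g [] ] ∣ (instF φ (freeF g T))) (eraseL-instF-freeF φ g T)

  eraseD-instD-freeBang : ∀ φ g T → eraseD (instD φ (freeBang g T)) ≡ T
  eraseD-instD-freeBang φ g T with φb φ (g [ 0 ])
  ... | false = trans (eraseL-§^ ∣ evalC φ [ g [] ] ∣ (instF φ (freeF g T))) (eraseL-instF-freeF φ g T)
  ... | true  = trans (eraseL-§^ (∣ evalC φ [ g [] ] ∣ ∸ 1) (instF φ (freeF g T))) (eraseL-instF-freeF φ g T)

eraseT-instT-freeTm′ : ∀ φ p M → eraseT (instT φ (freeTm′ p M)) ≡ M
eraseT-instT-freeTm′ φ p (var x T) =
  trans (eraseT-§ᶻ (φi φ (nodeP p)) _) (cong (var x) (eraseD-instD-freeBang φ (varP x T) T))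
eraseT-instT-freeTm′ φ p (lam x T M) =
  trans (eraseT-§ᶻ (φi φ (nodeP p)) _)
        (cong₂ (lam x) (eraseD-instD-freeBang φ (varP x T) T) (eraseT-instT-freeTm′ φ (0 ∷ p) M))
eraseT-instT-freeTm′ φ p (app M N) =
  trans (eraseT-§ᶻ (φi φ (nodeP p)) _)
        (cong₂ app (eraseT-instT-freeTm′ φ (0 ∷ p) M) (eraseT-instT-freeTm′ φ (1 ∷ p) N))
eraseT-instT-freeTm′ φ p (tlam α M) =
  trans (eraseT-§ᶻ (φi φ (nodeP p)) _) (cong (tlam α) (eraseT-instT-freeTm′ φ (0 ∷ p) M))
eraseT-instT-freeTm′ φ p (tapp M T) =
  trans (eraseT-§ᶻ (φi φ (nodeP p)) _)
        (cong₂ tapp (eraseT-instT-freeTm′ φ (0 ∷ p) M) (eraseL-instA-freeLin φ (targP p) T))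

⊑-trans : ∀ {u s t} → u ⊑ s → s ⊑ t → u ⊑ t
⊑-trans u⊑s here     = u⊑s
⊑-trans u⊑s (lam p)  = lam (⊑-trans u⊑s p)
⊑-trans u⊑s (appˡ p) = appˡ (⊑-trans u⊑s p)
⊑-trans u⊑s (appʳ p) = appʳ (⊑-trans u⊑s p)
⊑-trans u⊑s (tlam p) = tlam (⊑-trans u⊑s p)
⊑-trans u⊑s (tapp p) = tapp (⊑-trans u⊑s p)
⊑-trans u⊑s (§ p)    = § (⊑-trans u⊑s p)
⊑-trans u⊑s (§̄ p)    = §̄ (⊑-trans u⊑s p)

Regular-⊑ : ∀ {u s} → u ⊑ s → Regular s → Regular u
Regular-⊑ u⊑s reg v = (λ p → proj₁ (reg v) (⊑-trans p u⊑s)) , (λ p → proj₂ (reg v) (⊑-trans p u⊑s))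

§count : PTm → ℕ
§count (§ s) = suc (§count s)
§count _     = 0

§̄count : PTm → ℕ
§̄count (§̄ s) = suc (§̄count s)
§̄count _      = 0

exponent : PTm → ℤ
exponent (§ s)  = + suc (§count s)
exponent (§̄ s)  = -[1+ §̄count s ]
exponent _      = + 0

strip : PTm → PTm
strip (§ s)  = strip s
strip (§̄ s)  = strip s
strip s      = s

strip-⊑ : ∀ s → strip s ⊑ s
strip-⊑ (var x D)   = here
strip-⊑ (lam x D s) = here
strip-⊑ (app s s′)  = here
strip-⊑ (tlam α s)  = here
strip-⊑ (tapp s A)  = here
strip-⊑ (§ s)       = § (strip-⊑ s)
strip-⊑ (§̄ s)       = §̄ (strip-⊑ s)

§ᶻ-exponent-strip : ∀ s → Regular s → §ᶻ (exponent s) (strip s) ≡ s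
§ᶻ-exponent-strip (var x D)   _   = refl
§ᶻ-exponent-strip (lam x D s) _   = refl
§ᶻ-exponent-strip (app s s′)  _   = refl
§ᶻ-exponent-strip (tlam α s)  _   = refl
§ᶻ-exponent-strip (tapp s A)  _   = refl
§ᶻ-exponent-strip (§ s)       reg = §-prefix s reg
  where
  §-prefix : ∀ s → Regular (§ s) → §ᶻ (+ suc (§count s)) (strip s) ≡ § s
  §-prefix (var x D)   _   = refl
  §-prefix (lam x D s) _   = refl
  §-prefix (app s s′)  _   = refl
  §-prefix (tlam α s)  _   = refl
  §-prefix (tapp s A)  _   = refl
  §-prefix (§ s)       reg = cong § (§-prefix s (Regular-⊑ (§ here) reg))
  §-prefix (§̄ s)       reg = ⊥-elim (proj₁ (reg s) here)
§ᶻ-exponent-strip (§̄ s)       reg = §̄-prefix s reg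
  where
  §̄-prefix : ∀ s → Regular (§̄ s) → §ᶻ -[1+ §̄count s ] (strip s) ≡ §̄ s
  §̄-prefix (var x D)   _   = refl
  §̄-prefix (lam x D s) _   = refl
  §̄-prefix (app s s′)  _   = refl
  §̄-prefix (tlam α s)  _   = refl
  §̄-prefix (tapp s A)  _   = refl
  §̄-prefix (§ s)       reg = ⊥-elim (proj₂ (reg s) here)
  §̄-prefix (§̄ s)       reg = cong §̄ (§̄-prefix s (Regular-⊑ (§̄ here) reg))

-- Positions are reversed paths, as in freeTm′; each step strips the §ᵏ prefix.
childAt : ℕ → PTm → PTm
childAt 0 (lam x D b) = b
childAt 0 (app a b)   = a
childAt 1 (app a b)   = b
childAt 0 (tlam α b)  = b
childAt 0 (tapp b A)  = b
childAt _ u           = u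

subtermAt : List ℕ → PTm → PTm
subtermAt []      t = t
subtermAt (i ∷ p) t = childAt i (strip (subtermAt p t))

data HeadView : Tm → PTm → Set where
  var  : ∀ {x D} → HeadView (var x (eraseD D)) (var x D)
  lam  : ∀ {x D b M} → eraseT b ≡ M → HeadView (lam x (eraseD D) M) (lam x D b)
  app  : ∀ {a b M N} → eraseT a ≡ M → eraseT b ≡ N → HeadView (app M N) (app a b)
  tlam : ∀ {α b M} → eraseT b ≡ M → HeadView (tlam α M) (tlam α b)
  tapp : ∀ {b A M} → eraseT b ≡ M → HeadView (tapp M (eraseL A)) (tapp b A)

headView : ∀ s {M} → eraseT s ≡ M → HeadView M (strip s)
headView (var x D)   refl = var
headView (lam x D b) refl = lam refl
headView (app a b)   refl = app refl refl
headView (tlam α b)  refl = tlam refl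
headView (tapp b A)  refl = tapp refl
headView (§ s)       e    = headView s e
headView (§̄ s)       e    = headView s e

decorations : PTm → List (ℕ × DTy)
decorations (var x D)   = [ (x , D) ]
decorations (lam x D b) = (x , D) ∷ decorations b
decorations (app a b)   = decorations a ++ decorations b
decorations (tlam α b)  = decorations b
decorations (tapp b A)  = decorations b
decorations (§ b)       = decorations b
decorations (§̄ b)       = decorations b

decorations-⊑ : ∀ {u s d} → u ⊑ s → d ∈ decorations u → d ∈ decorations s
decorations-⊑ here              = λ d∈ → d∈
decorations-⊑ (lam p)           = there ∘ decorations-⊑ p
decorations-⊑ (appˡ p)          = ∈-++⁺ˡ ∘ decorations-⊑ p
decorations-⊑ (appʳ {t = a} p)  = ∈-++⁺ʳ (decorations a) ∘ decorations-⊑ p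
decorations-⊑ (tlam p)          = decorations-⊑ p
decorations-⊑ (tapp p)          = decorations-⊑ p
decorations-⊑ (§ p)             = decorations-⊑ p
decorations-⊑ (§̄ p)             = decorations-⊑ p

Occ⇒∈decorations : ∀ {x D s} → Occ x D s → (x , D) ∈ decorations s
Occ⇒∈decorations (inj₁ p)       = decorations-⊑ p (here refl)
Occ⇒∈decorations (inj₂ (_ , p)) = decorations-⊑ p (here refl)

Occ-⊑ : ∀ {x D s t} → s ⊑ t → Occ x D s → Occ x D t
Occ-⊑ s⊑t (inj₁ p)       = inj₁ (⊑-trans p s⊑t)
Occ-⊑ s⊑t (inj₂ (b , p)) = inj₂ (b , ⊑-trans p s⊑t)

∈decorations⇒Occ : ∀ {x D} s → (x , D) ∈ decorations s → Occ x D s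
∈decorations⇒Occ (var x D)   (here refl)  = inj₁ here
∈decorations⇒Occ (lam x D b) (here refl)  = inj₂ (b , here)
∈decorations⇒Occ (lam x D b) (there d∈)   = Occ-⊑ (lam here) (∈decorations⇒Occ b d∈)
∈decorations⇒Occ (app a b)   d∈ with ∈-++⁻ (decorations a) d∈
... | inj₁ d∈a = Occ-⊑ (appˡ here) (∈decorations⇒Occ a d∈a)
... | inj₂ d∈b = Occ-⊑ (appʳ here) (∈decorations⇒Occ b d∈b)
∈decorations⇒Occ (tlam α b)  d∈           = Occ-⊑ (tlam here) (∈decorations⇒Occ b d∈)
∈decorations⇒Occ (tapp b A)  d∈           = Occ-⊑ (tapp here) (∈decorations⇒Occ b d∈)
∈decorations⇒Occ (§ b)       d∈           = Occ-⊑ (§ here) (∈decorations⇒Occ b d∈)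
∈decorations⇒Occ (§̄ b)       d∈           = Occ-⊑ (§̄ here) (∈decorations⇒Occ b d∈)

IsDecorationOf : ℕ → Ty → ℕ × DTy → Set
IsDecorationOf x T (y , D) = x ≡ y × eraseD D ≡ T

isDecorationOf? : ∀ x T d → Dec (IsDecorationOf x T d)
isDecorationOf? x T (y , D) = x ≟ y ×-dec eraseD D ≟ᵀ T

-- The default for an absent variable is arbitrary.
decorationOf : ℕ → Ty → PTm → DTy
decorationOf x T s with any? (isDecorationOf? x T) (decorations s)
... | yes found = proj₂ (proj₁ (find found))
... | no _      = lin (tvar 0)

decorationOf-Occ : ∀ {x D s} → VarConsistent s → Occ x D s → decorationOf x (eraseD D) s ≡ D
decorationOf-Occ {x} {D} {s} consistent occ with any? (isDecorationOf? x (eraseD D)) (decorations s)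
... | no none   = ⊥-elim (none (lose (Occ⇒∈decorations occ) (refl , refl)))
... | yes found with find found
...   | (x , D′) , d∈ , (refl , erase≡) = consistent x D′ D (∈decorations⇒Occ s d∈) occ erase≡

typeArg : PTm → LTy
typeArg (tapp _ A) = A
typeArg _          = tvar 0

module ReadOff (t : PTm) (regular : Regular t) (consistent : VarConsistent t) where

  readInt : PName → ℤ
  readInt (varP x T q) = intParamD (decorationOf x T t) q
  readInt (nodeP p)    = exponent (subtermAt p t)
  readInt (targP p q)  = intParamL (typeArg (strip (subtermAt p t))) q

  readBool : PName → Bool
  readBool (varP x T q) = boolParamD (decorationOf x T t) q
  readBool (nodeP p)    = false
  readBool (targP p q)  = boolParamL (typeArg (strip (subtermAt p t))) q

  φ : Inst
  φ = record { φb = readBool ; φi = readInt }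

  varDec-agrees : ∀ {x D} → Occ x D t →
    AdmD φ (varDec x (eraseD D)) × instD φ (varDec x (eraseD D)) ≡ D
  varDec-agrees {x} {D} occ =
    freeBang-agrees D (agree (λ q → cong (λ D′ → intParamD D′ q) unique)
                             (λ q → cong (λ D′ → boolParamD D′ q) unique))
    where
    unique : decorationOf x (eraseD D) t ≡ D
    unique = decorationOf-Occ consistent occ

  typeArg-agrees : ∀ p {b A} → strip (subtermAt p t) ≡ tapp b A →
    AdmA φ (freeLin (targP p) (eraseL A)) × instA φ (freeLin (targP p) (eraseL A)) ≡ A
  typeArg-agrees p {A = A} eq =
    freeLin-agrees A (agree (λ q → cong (λ u → intParamL (typeArg u) q) eq)
                            (λ q → cong (λ u → boolParamL (typeArg u) q) eq))

  §ᶻ-exponent-subtermAt : ∀ p {w u} → subtermAt p t ⊑ t → strip (subtermAt p t) ≡ u → w ≡ u →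
    §ᶻ (exponent (subtermAt p t)) w ≡ subtermAt p t
  §ᶻ-exponent-subtermAt p s⊑t eq w≡u =
    trans (cong (§ᶻ (exponent s)) (trans w≡u (sym eq))) (§ᶻ-exponent-strip s (Regular-⊑ s⊑t regular))
    where
    s = subtermAt p t

  mutual
    decorate : ∀ M p {s} → subtermAt p t ≡ s → s ⊑ t → eraseT s ≡ M →
      AdmT φ (freeTm′ p M) × instT φ (freeTm′ p M) ≡ s
    decorate M p {s} refl s⊑t erase≡ =
      decorateHead M p s⊑t refl (⊑-trans (strip-⊑ s) s⊑t) (headView s erase≡)

    decorateHead : ∀ M p {u} → subtermAt p t ⊑ t → strip (subtermAt p t) ≡ u → u ⊑ t → HeadView M u →
      AdmT φ (freeTm′ p M) × instT φ (freeTm′ p M) ≡ subtermAt p t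
    decorateHead (var x _) p s⊑t eq u⊑t var =
      let admD , instD≡ = varDec-agrees (inj₁ u⊑t)
      in admD , §ᶻ-exponent-subtermAt p s⊑t eq (cong (var x) instD≡)
    decorateHead (lam x _ M) p s⊑t eq u⊑t (lam {b = b} eraseM) =
      let admD , instD≡ = varDec-agrees (inj₂ (b , u⊑t))
          admM , instM≡ = decorate M (0 ∷ p) (cong (childAt 0) eq) (⊑-trans (lam here) u⊑t) eraseM
      in (admD , admM) , §ᶻ-exponent-subtermAt p s⊑t eq (cong₂ (lam x) instD≡ instM≡)
    decorateHead (app M N) p s⊑t eq u⊑t (app eraseM eraseN) =
      let admM , instM≡ = decorate M (0 ∷ p) (cong (childAt 0) eq) (⊑-trans (appˡ here) u⊑t) eraseM
          admN , instN≡ = decorate N (1 ∷ p) (cong (childAt 1) eq) (⊑-trans (appʳ here) u⊑t) eraseN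
      in (admM , admN) , §ᶻ-exponent-subtermAt p s⊑t eq (cong₂ app instM≡ instN≡)
    decorateHead (tlam α M) p s⊑t eq u⊑t (tlam eraseM) =
      let admM , instM≡ = decorate M (0 ∷ p) (cong (childAt 0) eq) (⊑-trans (tlam here) u⊑t) eraseM
      in admM , §ᶻ-exponent-subtermAt p s⊑t eq (cong (tlam α) instM≡)
    decorateHead (tapp M _) p s⊑t eq u⊑t (tapp eraseM) =
      let admM , instM≡ = decorate M (0 ∷ p) (cong (childAt 0) eq) (⊑-trans (tapp here) u⊑t) eraseM
          admA , instA≡ = typeArg-agrees p eq
      in (admM , admA) , §ᶻ-exponent-subtermAt p s⊑t eq (cong₂ tapp instM≡ instA≡)

theorem4p1 : (M : Tm) (t : PTm) → Regular t → VarConsistent t →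
    (eraseT t ≡ M) ⇔ Σ Inst (λ φ → AdmT φ (freeTm M) × instT φ (freeTm M) ≡ t)
theorem4p1 M t regular consistent = mk⇔
  (λ erase≡ → φ , decorate M [] refl here erase≡)
  (λ (ψ , _ , inst≡) → trans (cong eraseT (sym inst≡)) (eraseT-instT-freeTm′ ψ [] M))
  where
  open ReadOff t regular consistent
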